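{- Let $q$ be a prime power, $r$ a positive integer, and let $f, g: \mathbb{F}_q^{2r+1} \to \mathbb{F}_q$ be linear bipermutive rules $f(x_0, \dots, x_{2r}) = a_0 x_0 + \cdots + a_{2r} x_{2r}$ and $g(x_0, \dots, x_{2r}) = b_0 x_0 + \cdots + b_{2r} x_{2r}$ (so $a_0, a_{2r}, b_0, b_{2r} \neq 0$). Then for every positive integer $t$ and $m = 2rt$, the squares $L_{\mathcal{F}}$ and $L_{\mathcal{G}}$ of order $q^m$ associated respectively to the linear CA $\mathcal{F} = \langle 2m, r, t, f\rangle: \mathbb{F}_q^{2m} \to \mathbb{F}_q^m$ and $\mathcal{G} = \langle 2m, r, t, g\rangle: \mathbb{F}_q^{2m} \to \mathbb{F}_q^m$ are orthogonal if and only if the polynomials $p_f(X) = a_0 + a_1 X + \cdots + a_{2r} X^{2r}$ and $p_g(X) = b_0 + b_1 X + \cdots + b_{2r} X^{2r}$ in $\mathbb{F}_q[X]$ are relatively prime.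
   Context: Cellular automaton: for positive integers $n, r, t$ with $t < \lfloor n/(2r) \rfloor$ and $f: A^{2r+1} \to A$, the CA $\langle n, r, t, f\rangle$ is the map $F_{t-1} \circ \cdots \circ F_0: A^n \to A^{n-2rt}$, where $F_i: A^{n-2ri} \to A^{n-2r(i+1)}$ sends $x = (x_0, \dots, x_{n-2ri-1})$ to the vector whose $j$-th coordinate is $f(x_j, \dots, x_{j+2r})$ for $j = 0, \dots, n-2r(i+1)-1$. Here $A = \mathbb{F}_q$ and $n = 2m$, so $\mathcal{F}$ maps $\mathbb{F}_q^{2m}$ to $\mathbb{F}_q^{m}$. A linear rule is bipermutive exactly when $a_0 \neq 0$ and $a_{2r} \neq 0$. Associated square: fix a total order on $\mathbb{F}_q^m$ and a monotone bijection $\phi: \mathbb{F}_q^m \to \{1, \dots, q^m\}$ with inverse $\psi$; the square associated to $\mathcal{F}$ is the $q^m \times q^m$ matrix $L_{\mathcal{F}}(i,j) = \phi(\mathcal{F}(\psi(i) \| \psi(j)))$, where $\|$ denotes concatenation of vectors. Two $v \times v$ squares $L_1, L_2$ are orthogonal if $(L_1(i_1,j_1), L_2(i_1,j_1)) \neq (L_1(i_2,j_2), L_2(i_2,j_2))$ whenever $(i_1,j_1) \neq (i_2,j_2)$. -}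

module Defs where

open import Level using (_⊔_)
open import Algebra.Bundles using (CommutativeRing)
open import Data.Nat using (ℕ; zero; suc; _+_; _*_; _^_)
open import Data.Nat.Properties using (+-mono-≤-<; +-assoc; *-comm)
open import Data.Nat.Primality using (Prime)
open import Data.Fin using (Fin; toℕ; fromℕ<; fromℕ; cast)
open import Data.Fin.Properties using (toℕ<n; toℕ≤pred[n])
open import Data.Fin.Patterns using (0F)
open import Data.Vec.Functional using (Vector; foldr; toList; _++_)
open import Data.List using (List; []; _∷_; [_])
open import Data.Product using (_×_; _,_; ∃; ∃-syntax)
open import Relation.Nullary using (¬_)
open import Relation.Binary.PropositionalEquality as ≡ using (_≡_; _≢_; refl; cong; sym; trans)
open import Relation.Binary.Bundles using (Setoid)
open import Function.Bundles using (Inverse)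
import Data.Vec.Functional.Relation.Binary.Equality.Setoid as VecEq

IsPrimePower : ℕ → Set
IsPrimePower q = ∃[ p ] ∃[ k ] (Prime p × q ≡ p ^ suc k)

Square : ℕ → Set
Square v = Fin v → Fin v → Fin v

Orthogonal : ∀ {v} → Square v → Square v → Set
Orthogonal {v} L₁ L₂ =
  ∀ (i₁ j₁ i₂ j₂ : Fin v) → (i₁ , j₁) ≢ (i₂ , j₂) →
  (L₁ i₁ j₁ , L₂ i₁ j₁) ≢ (L₁ i₂ j₂ , L₂ i₂ j₂)

module _ {c ℓ} (R : CommutativeRing c ℓ) where
  open CommutativeRing R using (Carrier; _≈_; 0#; 1#; setoid) renaming (_+_ to _⊕_; _*_ to _⊗_)

  record IsField : Set (c ⊔ ℓ) where
    field
      nontrivial : ¬ (1# ≈ 0#)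
      inverse    : ∀ x → ¬ (x ≈ 0#) → ∃[ y ] (x ⊗ y ≈ 1#)

  HasSize : ℕ → Set (c ⊔ ℓ)
  HasSize q = Inverse setoid (≡.setoid (Fin q))

  LocalRule : ℕ → Set c
  LocalRule r = Vector Carrier (suc (2 * r)) → Carrier

  -- the cell index j + i inside a vector of length 2r + k
  shift : (r k : ℕ) → Fin k → Fin (suc (2 * r)) → Fin (2 * r + k)
  shift r k j i = fromℕ< (+-mono-≤-< (toℕ≤pred[n] i) (toℕ<n j))

  step : (r : ℕ) → LocalRule r → (k : ℕ) → Vector Carrier (2 * r + k) → Vector Carrier k
  step r f k x j = f (λ i → x (shift r k j i))

  len : (r t k : ℕ) → ℕ
  len r zero    k = k
  len r (suc t) k = 2 * r + len r t k

  iterCA : (r t : ℕ) → LocalRule r → (k : ℕ) → Vector Carrier (len r t k) → Vector Carrier k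
  iterCA r zero    f k x = x
  iterCA r (suc t) f k x = iterCA r t f k (step r f (len r t k) x)

  len-lemma : ∀ r t k → len r t k ≡ t * (2 * r) + k
  len-lemma r zero k = refl
  len-lemma r (suc t) k = trans (cong (2 * r +_) (len-lemma r t k)) (sym (+-assoc (2 * r) (t * (2 * r)) k))

  len-half : ∀ r t → len r t (2 * r * t) ≡ 2 * r * t + 2 * r * t
  len-half r t = trans (len-lemma r t (2 * r * t)) (cong (_+ 2 * r * t) (*-comm t (2 * r)))

  CA : (r t : ℕ) → LocalRule r →
       Vector Carrier (2 * r * t + 2 * r * t) → Vector Carrier (2 * r * t)
  CA r t f x = iterCA r t f (2 * r * t) (λ i → x (cast (len-half r t) i))

  linearRule : (r : ℕ) → Vector Carrier (suc (2 * r)) → LocalRule r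
  linearRule r a x = foldr _⊕_ 0# (λ i → a i ⊗ x i)

  Bipermutive : (r : ℕ) → Vector Carrier (suc (2 * r)) → Set ℓ
  Bipermutive r a = ¬ (a 0F ≈ 0#) × ¬ (a (fromℕ (2 * r)) ≈ 0#)

  open VecEq setoid using (≋-setoid)

  assocSquare : ∀ {m q} → Inverse (≋-setoid m) (≡.setoid (Fin (q ^ m))) →
                (Vector Carrier (m + m) → Vector Carrier m) → Square (q ^ m)
  assocSquare φ F i j = Inverse.to φ (F (Inverse.from φ i ++ Inverse.from φ j))

  -- Univariate polynomials as coefficient lists (constant term first)

  Poly : Set c
  Poly = List Carrier

  coeff : Poly → ℕ → Carrier
  coeff []      _       = 0#
  coeff (a ∷ p) zero    = a
  coeff (a ∷ p) (suc n) = coeff p n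

  -- equality of polynomials (ignores trailing zero coefficients)
  _≈ₚ_ : Poly → Poly → Set ℓ
  p ≈ₚ p′ = ∀ n → coeff p n ≈ coeff p′ n

  _+ₚ_ : Poly → Poly → Poly
  []      +ₚ p′       = p′
  (a ∷ p) +ₚ []       = a ∷ p
  (a ∷ p) +ₚ (b ∷ p′) = (a ⊕ b) ∷ (p +ₚ p′)

  scaleₚ : Carrier → Poly → Poly
  scaleₚ a []      = []
  scaleₚ a (b ∷ p) = (a ⊗ b) ∷ scaleₚ a p

  _*ₚ_ : Poly → Poly → Poly
  []      *ₚ p′ = []
  (a ∷ p) *ₚ p′ = scaleₚ a p′ +ₚ (0# ∷ (p *ₚ p′))

  _∣ₚ_ : Poly → Poly → Set (c ⊔ ℓ)
  d ∣ₚ p = ∃[ e ] ((d *ₚ e) ≈ₚ p)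

  IsUnitₚ : Poly → Set (c ⊔ ℓ)
  IsUnitₚ u = ∃[ v ] ((u *ₚ v) ≈ₚ [ 1# ])

  RelativelyPrime : Poly → Poly → Set (c ⊔ ℓ)
  RelativelyPrime p p′ = ∀ d → d ∣ₚ p → d ∣ₚ p′ → IsUnitₚ d

  rulePoly : (r : ℕ) → Vector Carrier (suc (2 * r)) → Poly
  rulePoly r a = toList a

module Submission where

-- Polynomials act on sequences ℕ → K as linear difference
-- operators, (h · x) n = Σᵢ hᵢ x (n + i), turning polynomial products into
-- composition.  One step of the linear CA with rule a maps a window of a
-- sequence S to a window of a · S, so ⟨2m, r, t, a⟩ computes aᵗ · S on any
-- sequence S extending its input (CA-represents).  Orthogonality of the two
-- associated squares amounts to joint injectivity of the two CAs.
--   • If p_a, p_b are coprime, a Euclidean algorithm that divides from the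
--     constant-term end (possible as a₀, b₀ ≠ 0) gives u·a + v·b = 1.  Then a
--     difference w of two inputs with equal images satisfies aᵗ·w = bᵗ·w = 0
--     on [0, m); since aᵗ has degree m with nonzero leading coefficient
--     (a₂ᵣ ≠ 0), recurrence arguments force w = 0 on [0, 2m) (kernel).
--   • If d divides both and deg d ≥ 1, the recurrence of d has a solution S
--     with S 0 = 1; it solves both rules, so the cells (S|[0,m), S|[m,2m)) and
--     (0, 0) carry equal entries, contradicting orthogonality.
-- Decidability of equality in K comes from finiteness.  The file develops the operator calculus,
-- degrees, the CA representation and the square lemmas over any
-- commutative ring, then the recurrence, kernel and Bézout arguments over a
-- field, and derives theorem1 from the two directions.

open import Defs hiding (_+ₚ_; _*ₚ_; _≈ₚ_; _∣ₚ_)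
open import Level using (Level; _⊔_)
open import Algebra.Bundles using (CommutativeRing)
open import Data.Nat using (ℕ; zero; suc; _+_; _*_; _^_; _≤_; _<_; _≥_; z≤n; s≤s; _<?_)
import Data.Nat.Properties as ℕ
open import Data.List.Properties using (take-[])
open import Data.List using ([]; _∷_; [_]; length; take; replicate; _++_)
open import Data.Fin as Fin using (Fin; toℕ; fromℕ; fromℕ<)
import Data.Fin.Properties as Fin
open import Data.Vec.Functional using (Vector; foldr; toList)
import Data.Vec.Functional as Vec
import Data.Vec.Functional.Properties as Vec
import Data.Vec.Functional.Relation.Binary.Equality.Setoid as VecEq
open import Data.Product using (_×_; _,_; proj₁; proj₂; ∃-syntax)
open import Data.Product.Properties using (≡-dec)
open import Data.Sum using (_⊎_; inj₁; inj₂; [_,_]′)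
open import Data.Empty using (⊥-elim)
open import Relation.Nullary using (¬_; yes; no)
open import Relation.Nullary.Decidable using (via-injection)
open import Relation.Binary.Definitions using (Decidable)
open import Relation.Binary.PropositionalEquality as ≡ using (_≡_; refl; cong; cong₂)
open import Function.Bundles using (Inverse; Injection; _⇔_; mk⇔)
open import Function.Properties.Inverse using (Inverse⇒Injection)

module Theory {r₁ r₂} (K : CommutativeRing r₁ r₂) where



  open CommutativeRing K
    using (Carrier; _≈_; 0#; 1#; setoid; ring; +-commutativeSemigroup; *-commutativeSemigroup; +-abelianGroup;
           +-cong; *-cong; *-assoc; *-comm; +-identityˡ; +-identityʳ; *-identityˡ; *-identityʳ;
           zeroˡ; zeroʳ; distribˡ; distribʳ; -‿cong; -‿inverseʳ)
    renaming (_+_ to _⊕_; _*_ to _⊗_; -_ to ⊝_; refl to ≈-refl; sym to ≈-sym;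
              trans to ≈-trans; reflexive to ≈-reflexive; +-comm to ⊕-comm; +-assoc to ⊕-assoc)
  open import Algebra.Properties.Ring ring using (-‿distribˡ-*; -‿distribʳ-*; -0#≈0#; -‿+-comm)
  open import Algebra.Properties.CommutativeSemigroup +-commutativeSemigroup using (interchange)
  open import Algebra.Properties.CommutativeSemigroup *-commutativeSemigroup using () renaming (x∙yz≈y∙xz to *-swap)
  open import Algebra.Properties.AbelianGroup +-abelianGroup using (xyx⁻¹≈y; x∙y⁻¹≈ε⇒x≈y)
  open import Relation.Binary.Reasoning.Setoid setoid

  P : Set r₁
  P = Poly K

  coef : P → ℕ → Carrier
  coef = coeff K

  infixl 6 _+ₚ_
  infixl 7 _*ₚ_
  infix  4 _≈ₚ_ _∣ₚ_

  _+ₚ_ _*ₚ_ : P → P → P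
  _+ₚ_ = Defs._+ₚ_ K
  _*ₚ_ = Defs._*ₚ_ K

  _≈ₚ_ : P → P → Set r₂
  _≈ₚ_ = Defs._≈ₚ_ K

  _∣ₚ_ : P → P → Set (r₁ ⊔ r₂)
  _∣ₚ_ = Defs._∣ₚ_ K

  _·ₚ_ : Carrier → P → P
  _·ₚ_ = scaleₚ K

  oneₚ : P
  oneₚ = [ 1# ]

  Seq : Set r₁
  Seq = ℕ → Carrier

  0ˢ : Seq
  0ˢ _ = 0#

  infixl 6 _+ˢ_
  infixl 7 _·ˢ_
  infix  4 _≐_

  _+ˢ_ : Seq → Seq → Seq
  (x +ˢ y) n = x n ⊕ y n

  _·ˢ_ : Carrier → Seq → Seq
  (a ·ˢ x) n = a ⊗ x n

  -ˢ_ : Seq → Seq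
  (-ˢ x) n = ⊝ x n

  _≐_ : Seq → Seq → Set r₂
  x ≐ y = ∀ n → x n ≈ y n

  act : P → Seq → Seq
  act []      x n = 0#
  act (a ∷ h) x n = a ⊗ x n ⊕ act h x (suc n)

  act-cong : ∀ h {x y} → x ≐ y → act h x ≐ act h y
  act-cong []      x≐y n = ≈-refl
  act-cong (a ∷ h) x≐y n = +-cong (*-cong ≈-refl (x≐y n)) (act-cong h x≐y (suc n))

  act-0ˢ : ∀ h {x} → x ≐ 0ˢ → act h x ≐ 0ˢ
  act-0ˢ []      x≐0 n = ≈-refl
  act-0ˢ (a ∷ h) {x} x≐0 n = begin
    a ⊗ x n ⊕ act h x (suc n) ≈⟨ +-cong (*-cong ≈-refl (x≐0 n)) (act-0ˢ h x≐0 (suc n)) ⟩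
    a ⊗ 0# ⊕ 0#             ≈⟨ +-identityʳ _ ⟩
    a ⊗ 0#                  ≈⟨ zeroʳ a ⟩
    0#                      ∎

  act-shift : ∀ h x k n → act h (λ i → x (k + i)) n ≈ act h x (k + n)
  act-shift []      x k n = ≈-refl
  act-shift (a ∷ h) x k n =
    +-cong ≈-refl (≈-trans (act-shift h x k (suc n)) (≈-reflexive (cong (act h x) (ℕ.+-suc k n))))

  act-+ˢ : ∀ h x y → act h (x +ˢ y) ≐ act h x +ˢ act h y
  act-+ˢ []      x y n = ≈-sym (+-identityˡ 0#)
  act-+ˢ (a ∷ h) x y n = begin
    a ⊗ (x n ⊕ y n) ⊕ act h (x +ˢ y) (suc n)                  ≈⟨ +-cong (distribˡ a (x n) (y n)) (act-+ˢ h x y (suc n)) ⟩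
    (a ⊗ x n ⊕ a ⊗ y n) ⊕ (act h x (suc n) ⊕ act h y (suc n)) ≈⟨ interchange _ _ _ _ ⟩
    (a ⊗ x n ⊕ act h x (suc n)) ⊕ (a ⊗ y n ⊕ act h y (suc n)) ∎

  act-·ˢ : ∀ h b x → act h (b ·ˢ x) ≐ b ·ˢ act h x
  act-·ˢ []      b x n = ≈-sym (zeroʳ b)
  act-·ˢ (a ∷ h) b x n = begin
    a ⊗ (b ⊗ x n) ⊕ act h (b ·ˢ x) (suc n) ≈⟨ +-cong (*-swap a b (x n)) (act-·ˢ h b x (suc n)) ⟩
    b ⊗ (a ⊗ x n) ⊕ b ⊗ act h x (suc n)    ≈⟨ ≈-sym (distribˡ b _ _) ⟩
    b ⊗ (a ⊗ x n ⊕ act h x (suc n))        ∎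

  act-negˢ : ∀ h x → act h (-ˢ x) ≐ -ˢ act h x
  act-negˢ []      x n = ≈-sym -0#≈0#
  act-negˢ (a ∷ h) x n = begin
    a ⊗ (⊝ x n) ⊕ act h (-ˢ x) (suc n) ≈⟨ +-cong (≈-sym (-‿distribʳ-* a (x n))) (act-negˢ h x (suc n)) ⟩
    (⊝ (a ⊗ x n)) ⊕ (⊝ act h x (suc n)) ≈⟨ -‿+-comm _ _ ⟩
    ⊝ (a ⊗ x n ⊕ act h x (suc n))       ∎

  act-+ₚ : ∀ h g x → act (h +ₚ g) x ≐ act h x +ˢ act g x
  act-+ₚ []      g       x n = ≈-sym (+-identityˡ _)
  act-+ₚ (a ∷ h) []      x n = ≈-sym (+-identityʳ _)
  act-+ₚ (a ∷ h) (b ∷ g) x n = begin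
    (a ⊕ b) ⊗ x n ⊕ act (h +ₚ g) x (suc n)                     ≈⟨ +-cong (distribʳ (x n) a b) (act-+ₚ h g x (suc n)) ⟩
    (a ⊗ x n ⊕ b ⊗ x n) ⊕ (act h x (suc n) ⊕ act g x (suc n)) ≈⟨ interchange _ _ _ _ ⟩
    (a ⊗ x n ⊕ act h x (suc n)) ⊕ (b ⊗ x n ⊕ act g x (suc n)) ∎

  act-·ₚ : ∀ a h x → act (a ·ₚ h) x ≐ a ·ˢ act h x
  act-·ₚ a []      x n = ≈-sym (zeroʳ a)
  act-·ₚ a (b ∷ h) x n = begin
    (a ⊗ b) ⊗ x n ⊕ act (a ·ₚ h) x (suc n) ≈⟨ +-cong (*-assoc a b (x n)) (act-·ₚ a h x (suc n)) ⟩
    a ⊗ (b ⊗ x n) ⊕ a ⊗ act h x (suc n)    ≈⟨ ≈-sym (distribˡ a _ _) ⟩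
    a ⊗ (b ⊗ x n ⊕ act h x (suc n))        ∎

  act-X : ∀ h x n → act (0# ∷ h) x n ≈ act h x (suc n)
  act-X h x n = ≈-trans (+-cong (zeroˡ (x n)) ≈-refl) (+-identityˡ _)

  act-* : ∀ h g x → act (h *ₚ g) x ≐ act h (act g x)
  act-* []      g x n = ≈-refl
  act-* (a ∷ h) g x n = begin
    act (a ·ₚ g +ₚ (0# ∷ h *ₚ g)) x n               ≈⟨ act-+ₚ (a ·ₚ g) (0# ∷ h *ₚ g) x n ⟩
    act (a ·ₚ g) x n ⊕ act (0# ∷ h *ₚ g) x n        ≈⟨ +-cong (act-·ₚ a g x n) (act-X (h *ₚ g) x n) ⟩
    a ⊗ act g x n ⊕ act (h *ₚ g) x (suc n)          ≈⟨ +-cong ≈-refl (act-* h g x (suc n)) ⟩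
    a ⊗ act g x n ⊕ act h (act g x) (suc n)         ∎

  act-one : ∀ x → act oneₚ x ≐ x
  act-one x n = ≈-trans (+-identityʳ _) (*-identityˡ (x n))

  act-comm : ∀ h g x → act h (act g x) ≐ act g (act h x)
  act-comm []      g x n = ≈-sym (act-0ˢ g (λ _ → ≈-refl) n)
  act-comm (a ∷ h) g x n = begin
    a ⊗ act g x n ⊕ act h (act g x) (suc n)                  ≈⟨ +-cong ≈-refl (≈-sym (act-shift h (act g x) 1 n)) ⟩
    a ⊗ act g x n ⊕ act h (λ i → act g x (suc i)) n          ≈⟨ +-cong ≈-refl (act-cong h (λ i → ≈-sym (act-shift g x 1 i)) n) ⟩
    a ⊗ act g x n ⊕ act h (act g x′) n                       ≈⟨ +-cong ≈-refl (act-comm h g x′ n) ⟩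
    a ⊗ act g x n ⊕ act g (act h x′) n                       ≈⟨ +-cong ≈-refl (act-cong g (λ i → act-shift h x 1 i) n) ⟩
    a ⊗ act g x n ⊕ act g (λ i → act h x (suc i)) n          ≈⟨ +-cong (≈-sym (act-·ˢ g a x n)) ≈-refl ⟩
    act g (a ·ˢ x) n ⊕ act g (λ i → act h x (suc i)) n       ≈⟨ ≈-sym (act-+ˢ g _ _ n) ⟩
    act g (λ i → a ⊗ x i ⊕ act h x (suc i)) n                ∎
    where
    x′ : Seq
    x′ i = x (suc i)

  act-vanishing : ∀ h → (∀ k → coef h k ≈ 0#) → ∀ x → act h x ≐ 0ˢ
  act-vanishing []      h≈0 x n = ≈-refl
  act-vanishing (a ∷ h) h≈0 x n = begin
    a ⊗ x n ⊕ act h x (suc n) ≈⟨ +-cong (*-cong (h≈0 0) ≈-refl) (act-vanishing h (λ k → h≈0 (suc k)) x (suc n)) ⟩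
    0# ⊗ x n ⊕ 0#             ≈⟨ +-identityʳ _ ⟩
    0# ⊗ x n                  ≈⟨ zeroˡ (x n) ⟩
    0#                        ∎

  act-≈ₚ : ∀ h g → h ≈ₚ g → ∀ x → act h x ≐ act g x
  act-≈ₚ []      g       h≈g x n = ≈-sym (act-vanishing g (λ k → ≈-sym (h≈g k)) x n)
  act-≈ₚ (a ∷ h) []      h≈g x n = act-vanishing (a ∷ h) h≈g x n
  act-≈ₚ (a ∷ h) (b ∷ g) h≈g x n = +-cong (*-cong (h≈g 0) ≈-refl) (act-≈ₚ h g (λ k → h≈g (suc k)) x (suc n))

  -- A polynomial is determined by its action: acting on the unit sequence at
  -- position k reads off the k-th coefficient.  This turns identities between
  -- operators into identities between polynomials.

  unitˢ : ℕ → Seq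
  unitˢ zero    zero    = 1#
  unitˢ zero    (suc i) = 0#
  unitˢ (suc k) zero    = 0#
  unitˢ (suc k) (suc i) = unitˢ k i

  act-unitˢ : ∀ h k → act h (unitˢ k) 0 ≈ coef h k
  act-unitˢ []      k       = ≈-refl
  act-unitˢ (a ∷ h) zero    = begin
    a ⊗ 1# ⊕ act h (unitˢ 0) 1              ≈⟨ +-cong (*-identityʳ a) (≈-sym (act-shift h (unitˢ 0) 1 0)) ⟩
    a ⊕ act h (λ i → unitˢ 0 (suc i)) 0     ≈⟨ +-cong ≈-refl (act-0ˢ h (λ _ → ≈-refl) 0) ⟩
    a ⊕ 0#                                  ≈⟨ +-identityʳ a ⟩
    a                                       ∎
  act-unitˢ (a ∷ h) (suc k) = begin
    a ⊗ 0# ⊕ act h (unitˢ (suc k)) 1        ≈⟨ +-cong (zeroʳ a) (≈-sym (act-shift h (unitˢ (suc k)) 1 0)) ⟩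
    0# ⊕ act h (unitˢ k) 0                  ≈⟨ +-identityˡ _ ⟩
    act h (unitˢ k) 0                       ≈⟨ act-unitˢ h k ⟩
    coef h k                                ∎

  act-injective : ∀ h g → (∀ x → act h x ≐ act g x) → h ≈ₚ g
  act-injective h g h≐g k = ≈-trans (≈-sym (act-unitˢ h k)) (≈-trans (h≐g (unitˢ k) 0) (act-unitˢ g k))

  coef-+ₚ : ∀ h g k → coef (h +ₚ g) k ≈ coef h k ⊕ coef g k
  coef-+ₚ h g k = begin
    coef (h +ₚ g) k                                       ≈⟨ ≈-sym (act-unitˢ (h +ₚ g) k) ⟩
    act (h +ₚ g) (unitˢ k) 0                              ≈⟨ act-+ₚ h g (unitˢ k) 0 ⟩
    act h (unitˢ k) 0 ⊕ act g (unitˢ k) 0                 ≈⟨ +-cong (act-unitˢ h k) (act-unitˢ g k) ⟩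
    coef h k ⊕ coef g k                                   ∎

  coef-·ₚ : ∀ a h k → coef (a ·ₚ h) k ≈ a ⊗ coef h k
  coef-·ₚ a h k = begin
    coef (a ·ₚ h) k            ≈⟨ ≈-sym (act-unitˢ (a ·ₚ h) k) ⟩
    act (a ·ₚ h) (unitˢ k) 0   ≈⟨ act-·ₚ a h (unitˢ k) 0 ⟩
    a ⊗ act h (unitˢ k) 0      ≈⟨ *-cong ≈-refl (act-unitˢ h k) ⟩
    a ⊗ coef h k               ∎

  coef-∷* : ∀ a h g k → coef ((a ∷ h) *ₚ g) k ≈ a ⊗ coef g k ⊕ coef (0# ∷ h *ₚ g) k
  coef-∷* a h g k = ≈-trans (coef-+ₚ (a ·ₚ g) (0# ∷ h *ₚ g) k) (+-cong (coef-·ₚ a g k) ≈-refl)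

  ∣-refl : ∀ g → g ∣ₚ g
  ∣-refl g = oneₚ , act-injective (g *ₚ oneₚ) g λ x n → ≈-trans (act-* g oneₚ x n) (act-cong g (act-one x) n)

  ∣-zero : ∀ g → g ∣ₚ []
  ∣-zero g = [] , act-injective (g *ₚ []) [] λ x n → ≈-trans (act-* g [] x n) (act-0ˢ g (λ _ → ≈-refl) n)

  divisor-annihilates : ∀ d h → d ∣ₚ h → ∀ S → act d S ≐ 0ˢ → act h S ≐ 0ˢ
  divisor-annihilates d h (e , de≈h) S dS≐0 n = begin
    act h S n             ≈⟨ ≈-sym (act-≈ₚ (d *ₚ e) h de≈h S n) ⟩
    act (d *ₚ e) S n      ≈⟨ act-* d e S n ⟩
    act d (act e S) n     ≈⟨ act-comm d e S n ⟩
    act e (act d S) n     ≈⟨ act-0ˢ e dS≐0 n ⟩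
    0#                    ∎

  Below : P → ℕ → Set r₂
  Below h n = ∀ i → n ≤ i → coef h i ≈ 0#

  HasLead : P → ℕ → Carrier → Set r₂
  HasLead h n c = coef h n ≈ c × Below h (suc n)

  below-zero-* : ∀ A → Below A 0 → ∀ B → Below (A *ₚ B) 0
  below-zero-* A A≈0 B k _ = begin
    coef (A *ₚ B) k                ≈⟨ ≈-sym (act-unitˢ (A *ₚ B) k) ⟩
    act (A *ₚ B) (unitˢ k) 0       ≈⟨ act-* A B (unitˢ k) 0 ⟩
    act A (act B (unitˢ k)) 0      ≈⟨ act-vanishing A (λ i → A≈0 i z≤n) _ 0 ⟩
    0#                             ∎

  lead-* : ∀ A B {α β ca cb} → HasLead A α ca → HasLead B β cb → HasLead (A *ₚ B) (α + β) (ca ⊗ cb)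
  lead-* [] B (0≈ca , _) _ = ≈-sym (≈-trans (*-cong (≈-sym 0≈ca) ≈-refl) (zeroˡ _)) , λ _ _ → ≈-refl
  lead-* (a ∷ A) B {zero} (a≈ca , A-below) (B-lead , B-below) =
    ≈-trans (coef≈ _) (*-cong a≈ca B-lead) ,
    λ i β<i → ≈-trans (coef≈ i) (≈-trans (*-cong ≈-refl (B-below i β<i)) (zeroʳ a))
    where
    tail≈0 : ∀ k → coef (0# ∷ A *ₚ B) k ≈ 0#
    tail≈0 zero    = ≈-refl
    tail≈0 (suc k) = below-zero-* A (λ i _ → A-below (suc i) (s≤s z≤n)) B k z≤n
    coef≈ : ∀ k → coef ((a ∷ A) *ₚ B) k ≈ a ⊗ coef B k
    coef≈ k = ≈-trans (coef-∷* a A B k) (≈-trans (+-cong ≈-refl (tail≈0 k)) (+-identityʳ _))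
  lead-* (a ∷ A) B {suc α} {β} {ca} {cb} (A-lead , A-below) hB@(_ , B-below) =
    ≈-trans (beyond-B (α + β) (s≤s (ℕ.m≤n+m β α))) (proj₁ IH) ,
    λ { (suc i) (s≤s α+β<i) → ≈-trans (beyond-B i (s≤s (ℕ.≤-trans (ℕ.m≤n+m β α) (ℕ.<⇒≤ α+β<i))))
                                      (proj₂ IH i α+β<i) }
    where
    IH : HasLead (A *ₚ B) (α + β) (ca ⊗ cb)
    IH = lead-* A B (A-lead , λ i α<i → A-below (suc i) (s≤s α<i)) hB
    beyond-B : ∀ k → β < suc k → coef ((a ∷ A) *ₚ B) (suc k) ≈ coef (A *ₚ B) k
    beyond-B k β<k = begin
      coef ((a ∷ A) *ₚ B) (suc k)                  ≈⟨ coef-∷* a A B (suc k) ⟩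
      a ⊗ coef B (suc k) ⊕ coef (A *ₚ B) k         ≈⟨ +-cong (*-cong ≈-refl (B-below (suc k) β<k)) ≈-refl ⟩
      a ⊗ 0# ⊕ coef (A *ₚ B) k                     ≈⟨ +-cong (zeroʳ a) ≈-refl ⟩
      0# ⊕ coef (A *ₚ B) k                         ≈⟨ +-identityˡ _ ⟩
      coef (A *ₚ B) k                              ∎

  infixr 8 _^ₚ_

  _^ₚ_ : P → ℕ → P
  h ^ₚ zero  = oneₚ
  h ^ₚ suc t = h ^ₚ t *ₚ h

  act-local : ∀ h n → Below h n → ∀ x y j → (∀ i → i < n → x (j + i) ≈ y (j + i)) → act h x j ≈ act h y j
  act-local []      n       h-below x y j agree = ≈-refl
  act-local (a ∷ h) zero    h-below x y j agree =
    ≈-trans (act-vanishing (a ∷ h) (λ k → h-below k z≤n) x j) (≈-sym (act-vanishing (a ∷ h) (λ k → h-below k z≤n) y j))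
  act-local (a ∷ h) (suc n) h-below x y j agree = +-cong (*-cong ≈-refl head) tail
    where
    at : ∀ {i k} → i ≡ k → x i ≈ y i → x k ≈ y k
    at refl x≈y = x≈y
    head : x j ≈ y j
    head = at (ℕ.+-identityʳ j) (agree 0 (s≤s z≤n))
    tail : act h x (suc j) ≈ act h y (suc j)
    tail = act-local h n (λ i n≤i → h-below (suc i) (s≤s n≤i)) x y (suc j)
             (λ i i<n → at (ℕ.+-suc j i) (agree (suc i) (s≤s i<n)))

  take-below : ∀ n h → Below (take n h) n
  take-below zero    h       i       _         = ≈-refl
  take-below (suc n) []      i       _         = ≈-refl
  take-below (suc n) (a ∷ h) (suc i) (s≤s n≤i) = take-below n h i n≤i

  split-lead : ∀ h n {c} → HasLead h n c → ∀ x j → act h x j ≈ act (take n h) x j ⊕ c ⊗ x (j + n)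
  split-lead []      n       {c} (0≈c , _) x j =
    ≡.subst (λ l → 0# ≈ act l x j ⊕ c ⊗ x (j + n)) (≡.sym (take-[] n)) (≈-sym (begin
      0# ⊕ c ⊗ x (j + n)    ≈⟨ +-identityˡ _ ⟩
      c ⊗ x (j + n)         ≈⟨ *-cong (≈-sym 0≈c) ≈-refl ⟩
      0# ⊗ x (j + n)        ≈⟨ zeroˡ _ ⟩
      0#                    ∎))
  split-lead (a ∷ h) zero    {c} (a≈c , h-below) x j = begin
    a ⊗ x j ⊕ act h x (suc j)        ≈⟨ +-cong (*-cong a≈c (≈-reflexive (cong x (≡.sym (ℕ.+-identityʳ j))))) h≈0 ⟩
    c ⊗ x (j + 0) ⊕ 0#               ≈⟨ ⊕-comm _ _ ⟩
    0# ⊕ c ⊗ x (j + 0)               ∎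
    where
    h≈0 : act h x (suc j) ≈ 0#
    h≈0 = act-vanishing h (λ k → h-below (suc k) (s≤s z≤n)) x (suc j)
  split-lead (a ∷ h) (suc n) {c} (h-lead , h-below) x j = begin
    a ⊗ x j ⊕ act h x (suc j)
      ≈⟨ +-cong ≈-refl (split-lead h n (h-lead , λ i n<i → h-below (suc i) (s≤s n<i)) x (suc j)) ⟩
    a ⊗ x j ⊕ (act (take n h) x (suc j) ⊕ c ⊗ x (suc j + n))
      ≈⟨ ≈-sym (⊕-assoc _ _ _) ⟩
    (a ⊗ x j ⊕ act (take n h) x (suc j)) ⊕ c ⊗ x (suc j + n)
      ≈⟨ +-cong ≈-refl (*-cong ≈-refl (≈-reflexive (cong x (≡.sym (ℕ.+-suc j n))))) ⟩
    (a ⊗ x j ⊕ act (take n h) x (suc j)) ⊕ c ⊗ x (j + suc n) ∎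

  Agrees : ∀ {n} → Vector Carrier n → Seq → Set r₂
  Agrees z S = ∀ f → z f ≈ S (toℕ f)

  foldr-act : ∀ {n} (a y : Vector Carrier n) S s → (∀ i → y i ≈ S (s + toℕ i)) →
              foldr _⊕_ 0# (λ i → a i ⊗ y i) ≈ act (toList a) S s
  foldr-act {zero}  a y S s y≈S = ≈-refl
  foldr-act {suc n} a y S s y≈S =
    +-cong (*-cong ≈-refl (≈-trans (y≈S Fin.zero) (≈-reflexive (cong S (ℕ.+-identityʳ s)))))
           (foldr-act (λ i → a (Fin.suc i)) (λ i → y (Fin.suc i)) S (suc s)
              (λ i → ≈-trans (y≈S (Fin.suc i)) (≈-reflexive (cong S (ℕ.+-suc s (toℕ i))))))

  step-represents : ∀ r a k x S → Agrees x S → Agrees (step K r (linearRule K r a) k x) (act (toList a) S)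
  step-represents r a k x S x≈S j = foldr-act a _ S (toℕ j) λ i →
    ≈-trans (x≈S (shift K r k j i))
            (≈-reflexive (cong S (≡.trans (Fin.toℕ-fromℕ< _) (ℕ.+-comm (toℕ i) (toℕ j)))))

  iterCA-represents : ∀ r a t k x S → Agrees x S →
                      Agrees (iterCA K r t (linearRule K r a) k x) (act (toList a ^ₚ t) S)
  iterCA-represents r a zero    k x S x≈S j = ≈-trans (x≈S j) (≈-sym (act-one S (toℕ j)))
  iterCA-represents r a (suc t) k x S x≈S j =
    ≈-trans (iterCA-represents r a t k _ (act (toList a) S) (step-represents r a _ x S x≈S) j)
            (≈-sym (act-* (toList a ^ₚ t) (toList a) S (toℕ j)))

  CA-represents : ∀ r a t x S → Agrees x S → Agrees (CA K r t (linearRule K r a) x) (act (toList a ^ₚ t) S)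
  CA-represents r a t x S x≈S = iterCA-represents r a t _ _ S λ f →
    ≈-trans (x≈S (Fin.cast _ f)) (≈-reflexive (cong S (Fin.toℕ-cast _ f)))

  coef-toList : ∀ {n} (a : Vector Carrier n) i → coef (toList a) (toℕ i) ≡ a i
  coef-toList a Fin.zero    = refl
  coef-toList a (Fin.suc i) = coef-toList (λ j → a (Fin.suc j)) i

  below-toList : ∀ {n} (a : Vector Carrier n) → Below (toList a) n
  below-toList {zero}  a i       _         = ≈-refl
  below-toList {suc n} a (suc i) (s≤s n≤i) = below-toList (λ j → a (Fin.suc j)) i n≤i

  lead-toList : ∀ n (a : Vector Carrier (suc n)) → HasLead (toList a) n (a (fromℕ n))
  lead-toList n a = ≈-reflexive (≡.trans (cong (coef (toList a)) (≡.sym (Fin.toℕ-fromℕ n))) (coef-toList a (fromℕ n)))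
                  , below-toList a

  extend : ∀ {n} → Vector Carrier n → Seq
  extend z = coef (toList z)

  extend-agrees : ∀ {n} (z : Vector Carrier n) → Agrees z (extend z)
  extend-agrees z f = ≈-reflexive (≡.sym (coef-toList z f))

  ++-agrees : ∀ {m n} (u : Vector Carrier m) (v : Vector Carrier n) S →
              Agrees u S → (∀ f → v f ≈ S (m + toℕ f)) → Agrees (u Vec.++ v) S
  ++-agrees {m} {n} u v S u≈S v≈S f =
    ≡.subst (λ g → (u Vec.++ v) g ≈ S (toℕ g)) (Fin.join-splitAt m n f) (on-halves (Fin.splitAt m f))
    where
    on-halves : ∀ p → (u Vec.++ v) (Fin.join m n p) ≈ S (toℕ (Fin.join m n p))
    on-halves (inj₁ k) = ≈-trans (≈-reflexive (Vec.lookup-++ˡ u v k))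
                                 (≈-trans (u≈S k) (≈-reflexive (cong S (≡.sym (Fin.toℕ-↑ˡ k n)))))
    on-halves (inj₂ k) = ≈-trans (≈-reflexive (Vec.lookup-++ʳ u v k))
                                 (≈-trans (v≈S k) (≈-reflexive (cong S (≡.sym (Fin.toℕ-↑ʳ m k)))))

  CA-vanishes : ∀ r t a y S → 1 ≤ t → act (toList a) S ≐ 0ˢ → Agrees y S → ∀ f → CA K r t (linearRule K r a) y f ≈ 0#
  CA-vanishes r (suc t) a y S _ aS≐0 y≈S f = begin
    CA K r (suc t) (linearRule K r a) y f           ≈⟨ CA-represents r a (suc t) y S y≈S f ⟩
    act (toList a ^ₚ suc t) S (toℕ f)               ≈⟨ act-* (toList a ^ₚ t) (toList a) S (toℕ f) ⟩
    act (toList a ^ₚ t) (act (toList a) S) (toℕ f)  ≈⟨ act-0ˢ (toList a ^ₚ t) aS≐0 (toℕ f) ⟩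
    0#                                              ∎

  open VecEq setoid using (≋-setoid; _≋_)

  module _ {m q} (φ : Inverse (≋-setoid m) (≡.setoid (Fin (q ^ m))))
           (F G : Vector Carrier (m + m) → Vector Carrier m) where

    open Inverse φ using (to; from; to-cong; strictlyInverseˡ)

    private
      to-injective : ∀ {u u′} → to u ≡ to u′ → u ≋ u′
      to-injective = Injection.injective (Inverse⇒Injection φ)

      from-injective : ∀ {i i′} → from i ≋ from i′ → i ≡ i′
      from-injective {i} {i′} eq = ≡.trans (≡.sym (strictlyInverseˡ i)) (≡.trans (to-cong eq) (strictlyInverseˡ i′))

    orthogonal-if-injective : (∀ y y′ → F y ≋ F y′ → G y ≋ G y′ → y ≋ y′) →
                              Orthogonal (assocSquare K φ F) (assocSquare K φ G)
    orthogonal-if-injective injective i j i′ j′ ij≢i′j′ same =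
      ij≢i′j′ (cong₂ _,_ (from-injective left-halves) (from-injective right-halves))
      where
      y≋y′ : (from i Vec.++ from j) ≋ (from i′ Vec.++ from j′)
      y≋y′ = injective _ _ (to-injective (cong proj₁ same)) (to-injective (cong proj₂ same))
      left-halves : from i ≋ from i′
      left-halves k = ≈-trans (≈-reflexive (≡.sym (Vec.lookup-++ˡ (from i) (from j) k)))
                              (≈-trans (y≋y′ (k Fin.↑ˡ m)) (≈-reflexive (Vec.lookup-++ˡ (from i′) (from j′) k)))
      right-halves : from j ≋ from j′
      right-halves k = ≈-trans (≈-reflexive (≡.sym (Vec.lookup-++ʳ (from i) (from j) k)))
                               (≈-trans (y≋y′ (m Fin.↑ʳ k)) (≈-reflexive (Vec.lookup-++ʳ (from i′) (from j′) k)))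

    orthogonal-separates : Orthogonal (assocSquare K φ F) (assocSquare K φ G) → ∀ u v u′ v′ →
      F (from (to u) Vec.++ from (to v)) ≋ F (from (to u′) Vec.++ from (to v′)) →
      G (from (to u) Vec.++ from (to v)) ≋ G (from (to u′) Vec.++ from (to v′)) → u ≋ u′
    orthogonal-separates orthogonal u v u′ v′ F≋ G≋ with ≡-dec Fin._≟_ Fin._≟_ (to u , to v) (to u′ , to v′)
    ... | yes same = to-injective (cong proj₁ same)
    ... | no  differ = ⊥-elim (orthogonal _ _ _ _ differ (cong₂ _,_ (to-cong F≋) (to-cong G≋)))

  -- a sequence S with S 0 ≠ 0 annihilated by both rule polynomials gives two
  -- different cells (S|[0,m), S|[m,2m)) and (0, 0) with the same pair of entries
  common-solution⇒¬orthogonal :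
    ∀ {q} r t a b → 1 ≤ t → 1 ≤ 2 * r * t →
    (φ : Inverse (≋-setoid (2 * r * t)) (≡.setoid (Fin (q ^ (2 * r * t))))) →
    ∀ S → act (toList a) S ≐ 0ˢ → act (toList b) S ≐ 0ˢ → ¬ S 0 ≈ 0# →
    ¬ Orthogonal (assocSquare K φ (CA K r t (linearRule K r a))) (assocSquare K φ (CA K r t (linearRule K r b)))
  common-solution⇒¬orthogonal r t a b t≥1 m≥1 φ S aS≐0 bS≐0 S0≉0 orthogonal =
    S0≉0 (≈-trans (≈-reflexive (cong S (≡.sym (Fin.toℕ-fromℕ< m≥1))))
                  (low≋0 (fromℕ< m≥1)))
    where
    open Inverse φ using (to; from; strictlyInverseʳ)
    m : ℕ
    m = 2 * r * t
    low high zero⃗ : Vector Carrier m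
    low  f = S (toℕ f)
    high f = S (m + toℕ f)
    zero⃗ f = 0#
    -- both cells are initial segments of sequences annihilated by h (S and 0),
    -- so the CA with rule h sends both to zero
    same : ∀ h → act (toList h) S ≐ 0ˢ → CA K r t (linearRule K r h) (from (to low) Vec.++ from (to high))
                                        ≋ CA K r t (linearRule K r h) (from (to zero⃗) Vec.++ from (to zero⃗))
    same h hS≐0 f = ≈-trans (CA-vanishes r t h _ S t≥1 hS≐0 (++-agrees _ _ S (strictlyInverseʳ low) (strictlyInverseʳ high)) f)
                            (≈-sym (CA-vanishes r t h _ 0ˢ t≥1 (act-0ˢ (toList h) (λ _ → ≈-refl))
                                      (++-agrees _ _ 0ˢ (strictlyInverseʳ zero⃗) (strictlyInverseʳ zero⃗)) f))
    low≋0 : low ≋ zero⃗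
    low≋0 = orthogonal-separates φ (CA K r t (linearRule K r a)) (CA K r t (linearRule K r b)) orthogonal
                                 low high zero⃗ zero⃗ (same a aS≐0) (same b bS≐0)

  -- Membership in the ideal (A, B), witnessed at the level of operators.

  record Combination (A B h : P) : Set (r₁ ⊔ r₂) where
    constructor combination
    field
      u v      : P
      identity : ∀ x → act h x ≐ act u (act A x) +ˢ act v (act B x)

  act-combination : ∀ k u v y z → act k (act u y +ˢ act v z) ≐ act (k *ₚ u) y +ˢ act (k *ₚ v) z
  act-combination k u v y z n = begin
    act k (act u y +ˢ act v z) n                ≈⟨ act-+ˢ k _ _ n ⟩
    act k (act u y) n ⊕ act k (act v z) n       ≈⟨ ≈-sym (+-cong (act-* k u y n) (act-* k v z n)) ⟩
    act (k *ₚ u) y n ⊕ act (k *ₚ v) z n         ∎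

  module _ {A B : P} where

    combination-left : Combination A B A
    combination-left = combination oneₚ [] λ x n → ≈-sym (≈-trans (+-identityʳ _) (act-one (act A x) n))

    combination-right : Combination A B B
    combination-right = combination [] oneₚ λ x n → ≈-sym (≈-trans (+-identityˡ _) (act-one (act B x) n))

    combination-cong : ∀ {h h′} → (∀ x → act h x ≐ act h′ x) → Combination A B h → Combination A B h′
    combination-cong h≐h′ (combination u v eq) = combination u v λ x n → ≈-trans (≈-sym (h≐h′ x n)) (eq x n)

    combination-+ : ∀ {h g} → Combination A B h → Combination A B g → Combination A B (h +ₚ g)
    combination-+ {h} {g} (combination u v h≐) (combination u′ v′ g≐) =
      combination (u +ₚ u′) (v +ₚ v′) λ x n → begin
        act (h +ₚ g) x n
          ≈⟨ act-+ₚ h g x n ⟩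
        act h x n ⊕ act g x n
          ≈⟨ +-cong (h≐ x n) (g≐ x n) ⟩
        (act u (act A x) n ⊕ act v (act B x) n) ⊕ (act u′ (act A x) n ⊕ act v′ (act B x) n)
          ≈⟨ interchange _ _ _ _ ⟩
        (act u (act A x) n ⊕ act u′ (act A x) n) ⊕ (act v (act B x) n ⊕ act v′ (act B x) n)
          ≈⟨ ≈-sym (+-cong (act-+ₚ u u′ _ n) (act-+ₚ v v′ _ n)) ⟩
        act (u +ₚ u′) (act A x) n ⊕ act (v +ₚ v′) (act B x) n ∎

    combination-· : ∀ {h} a → Combination A B h → Combination A B (a ·ₚ h)
    combination-· {h} a (combination u v h≐) = combination (a ·ₚ u) (a ·ₚ v) λ x n → begin
      act (a ·ₚ h) x n                                        ≈⟨ act-·ₚ a h x n ⟩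
      a ⊗ act h x n                                           ≈⟨ *-cong ≈-refl (h≐ x n) ⟩
      a ⊗ (act u (act A x) n ⊕ act v (act B x) n)             ≈⟨ distribˡ a _ _ ⟩
      a ⊗ act u (act A x) n ⊕ a ⊗ act v (act B x) n           ≈⟨ ≈-sym (+-cong (act-·ₚ a u _ n) (act-·ₚ a v _ n)) ⟩
      act (a ·ₚ u) (act A x) n ⊕ act (a ·ₚ v) (act B x) n     ∎

    combination-* : ∀ {h} k → Combination A B h → Combination A B (k *ₚ h)
    combination-* {h} k (combination u v h≐) = combination (k *ₚ u) (k *ₚ v) λ x n →
      ≈-trans (act-* k h x n) (≈-trans (act-cong k (h≐ x) n) (act-combination k u v (act A x) (act B x) n))

  combination-swap : ∀ {A B h} → Combination A B h → Combination B A h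
  combination-swap (combination u v eq) = combination v u λ x n → ≈-trans (eq x n) (⊕-comm _ _)

  combination-trans : ∀ {A B D h} → Combination A B D → Combination D B h → Combination A B h
  combination-trans {A} {B} {D} {h} (combination u′ v′ D≐) (combination u v h≐) =
    combination (u *ₚ u′) (u *ₚ v′ +ₚ v) λ x n → begin
      act h x n
        ≈⟨ h≐ x n ⟩
      act u (act D x) n ⊕ act v (act B x) n
        ≈⟨ +-cong (≈-trans (act-cong u (D≐ x) n) (act-combination u u′ v′ _ _ n)) ≈-refl ⟩
      (act (u *ₚ u′) (act A x) n ⊕ act (u *ₚ v′) (act B x) n) ⊕ act v (act B x) n
        ≈⟨ ⊕-assoc _ _ _ ⟩
      act (u *ₚ u′) (act A x) n ⊕ (act (u *ₚ v′) (act B x) n ⊕ act v (act B x) n)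
        ≈⟨ +-cong ≈-refl (≈-sym (act-+ₚ (u *ₚ v′) v _ n)) ⟩
      act (u *ₚ u′) (act A x) n ⊕ act (u *ₚ v′ +ₚ v) (act B x) n ∎

  unit-combination : ∀ A B → IsUnitₚ K B → Combination A B oneₚ
  unit-combination A B (w , Bw≈1) = combination [] w λ x n → begin
    act oneₚ x n                  ≈⟨ ≈-sym (act-≈ₚ (B *ₚ w) oneₚ Bw≈1 x n) ⟩
    act (B *ₚ w) x n              ≈⟨ act-* B w x n ⟩
    act B (act w x) n             ≈⟨ act-comm B w x n ⟩
    act w (act B x) n             ≈⟨ ≈-sym (+-identityˡ _) ⟩
    0# ⊕ act w (act B x) n        ∎

  coprime-powers : ∀ {A B} → Combination A B oneₚ → ∀ t s x →
                   act (A ^ₚ t) x ≐ 0ˢ → act (B ^ₚ s) x ≐ 0ˢ → x ≐ 0ˢ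
  coprime-powers AB=1 zero    s       x Aᵗx≐0 Bˢx≐0 n = ≈-trans (≈-sym (act-one x n)) (Aᵗx≐0 n)
  coprime-powers AB=1 (suc t) zero    x Aᵗx≐0 Bˢx≐0 n = ≈-trans (≈-sym (act-one x n)) (Bˢx≐0 n)
  coprime-powers {A} {B} AB=1@(combination u v one≐) (suc t) (suc s) x Aᵗx≐0 Bˢx≐0 n = begin
    x n                                       ≈⟨ ≈-sym (act-one x n) ⟩
    act oneₚ x n                              ≈⟨ one≐ x n ⟩
    act u (act A x) n ⊕ act v (act B x) n     ≈⟨ +-cong (act-0ˢ u Ax≐0 n) (act-0ˢ v Bx≐0 n) ⟩
    0# ⊕ 0#                                   ≈⟨ +-identityˡ 0# ⟩
    0#                                        ∎
    where
    -- A·x is annihilated by Aᵗ and by Bˢ⁺¹, so it vanishes by induction; likewise B·x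
    Ax≐0 : act A x ≐ 0ˢ
    Ax≐0 = coprime-powers AB=1 t (suc s) (act A x)
      (λ i → ≈-trans (≈-sym (act-* (A ^ₚ t) A x i)) (Aᵗx≐0 i))
      (λ i → ≈-trans (act-comm (B ^ₚ suc s) A x i) (act-0ˢ A Bˢx≐0 i))
    Bx≐0 : act B x ≐ 0ˢ
    Bx≐0 = coprime-powers AB=1 (suc t) s (act B x)
      (λ i → ≈-trans (act-comm (A ^ₚ suc t) B x i) (act-0ˢ B Aᵗx≐0 i))
      (λ i → ≈-trans (≈-sym (act-* (B ^ₚ s) B x i)) (Bˢx≐0 i))

  -- One step of the Euclidean algorithm, A = c·B + Xᵏ·D, seen through common
  -- divisors and through the ideal (A, B).

  shiftₚ : ℕ → P → P
  shiftₚ k D = replicate k 0# ++ D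

  act-shiftₚ : ∀ k D x n → act (shiftₚ k D) x n ≈ act D x (k + n)
  act-shiftₚ zero    D x n = ≈-refl
  act-shiftₚ (suc k) D x n =
    ≈-trans (act-X (shiftₚ k D) x n) (≈-trans (act-shiftₚ k D x (suc n)) (≈-reflexive (cong (act D x) (ℕ.+-suc k n))))

  record Reduces (A B : P) (c : Carrier) (k : ℕ) (D : P) : Set (r₁ ⊔ r₂) where
    constructor reduces
    field
      identity : ∀ x n → act A x n ≈ c ⊗ act B x n ⊕ act D x (k + n)

  reduces-combination : ∀ {A B c k D} → Reduces A B c k D → Combination A B (shiftₚ k D)
  reduces-combination {A} {B} {c} {k} {D} (reduces A≈) =
    combination-cong A-cB≐XᵏD (combination-+ combination-left (combination-· (⊝ c) combination-right))
    where
    A-cB≐XᵏD : ∀ x → act (A +ₚ (⊝ c) ·ₚ B) x ≐ act (shiftₚ k D) x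
    A-cB≐XᵏD x n = begin
      act (A +ₚ (⊝ c) ·ₚ B) x n                               ≈⟨ ≈-trans (act-+ₚ A _ x n) (+-cong ≈-refl (act-·ₚ (⊝ c) B x n)) ⟩
      act A x n ⊕ (⊝ c) ⊗ act B x n                           ≈⟨ +-cong (A≈ x n) (≈-sym (-‿distribˡ-* c _)) ⟩
      c ⊗ act B x n ⊕ act D x (k + n) ⊕ ⊝ (c ⊗ act B x n)     ≈⟨ xyx⁻¹≈y _ _ ⟩
      act D x (k + n)                                         ≈⟨ ≈-sym (act-shiftₚ k D x n) ⟩
      act (shiftₚ k D) x n                                    ∎

  reduces-divisors : ∀ {A B c k D} → Reduces A B c k D → ∀ g → g ∣ₚ D → g ∣ₚ B → g ∣ₚ A
  reduces-divisors {A} {B} {c} {k} {D} (reduces A≈) g (e₁ , ge₁≈D) (e₂ , ge₂≈B) = E , act-injective (g *ₚ E) A ge≐A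
    where
    E : P
    E = c ·ₚ e₂ +ₚ shiftₚ k e₁
    ge≐A : ∀ x → act (g *ₚ E) x ≐ act A x
    ge≐A x n = begin
      act (g *ₚ E) x n
        ≈⟨ act-* g E x n ⟩
      act g (act E x) n
        ≈⟨ act-cong g Ex n ⟩
      act g (c ·ˢ act e₂ x +ˢ (λ i → act e₁ x (k + i))) n
        ≈⟨ act-+ˢ g _ _ n ⟩
      act g (c ·ˢ act e₂ x) n ⊕ act g (λ i → act e₁ x (k + i)) n
        ≈⟨ +-cong (act-·ˢ g c _ n) (act-shift g _ k n) ⟩
      c ⊗ act g (act e₂ x) n ⊕ act g (act e₁ x) (k + n)
        ≈⟨ ≈-sym (+-cong (*-cong ≈-refl (act-* g e₂ x n)) (act-* g e₁ x _)) ⟩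
      c ⊗ act (g *ₚ e₂) x n ⊕ act (g *ₚ e₁) x (k + n)
        ≈⟨ +-cong (*-cong ≈-refl (act-≈ₚ (g *ₚ e₂) B ge₂≈B x n)) (act-≈ₚ (g *ₚ e₁) D ge₁≈D x _) ⟩
      c ⊗ act B x n ⊕ act D x (k + n)
        ≈⟨ ≈-sym (A≈ x n) ⟩
      act A x n ∎
      where
      Ex : act E x ≐ c ·ˢ act e₂ x +ˢ (λ i → act e₁ x (k + i))
      Ex i = ≈-trans (act-+ₚ (c ·ₚ e₂) _ x i) (+-cong (act-·ₚ c e₂ x i) (act-shiftₚ k e₁ x i))

  X-identity : ∀ b B′ h x → act (h *ₚ (b ∷ B′)) x +ˢ -ˢ act (B′ *ₚ (0# ∷ h)) x ≐ b ·ˢ act h x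
  X-identity b B′ h x n = begin
    act (h *ₚ (b ∷ B′)) x n ⊕ ⊝ act (B′ *ₚ (0# ∷ h)) x n
      ≈⟨ +-cong (≈-trans (act-* h (b ∷ B′) x n) (act-comm h (b ∷ B′) x n)) (-‿cong XH≈) ⟩
    (b ⊗ act h x n ⊕ Y) ⊕ ⊝ Y
      ≈⟨ ⊕-assoc _ _ _ ⟩
    b ⊗ act h x n ⊕ (Y ⊕ ⊝ Y)
      ≈⟨ +-cong ≈-refl (-‿inverseʳ Y) ⟩
    b ⊗ act h x n ⊕ 0#
      ≈⟨ +-identityʳ _ ⟩
    b ⊗ act h x n ∎
    where
    Y : Carrier
    Y = act B′ (act h x) (suc n)
    XH≈ : act (B′ *ₚ (0# ∷ h)) x n ≈ Y
    XH≈ = ≈-trans (act-* B′ _ x n) (≈-trans (act-cong B′ (act-X h x) n) (act-shift B′ (act h x) 1 n))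

  -- length bookkeeping for the termination of the Euclidean algorithm
  length-·ₚ : ∀ a h → length (a ·ₚ h) ≡ length h
  length-·ₚ a []      = refl
  length-·ₚ a (b ∷ h) = cong suc (length-·ₚ a h)

  length-+ₚ : ∀ h g → length g ≤ length h → length (h +ₚ g) ≤ length h
  length-+ₚ []      []      _         = z≤n
  length-+ₚ (a ∷ h) []      _         = ℕ.≤-refl
  length-+ₚ (a ∷ h) (b ∷ g) (s≤s g≤h) = s≤s (length-+ₚ h g g≤h)

  -- Over a field: linear recurrences whose polynomial has a nonzero leading
  -- coefficient can be solved forward uniquely from their initial values.

  module Field (isField : IsField K) where

    open IsField isField

    inv : ∀ c → ¬ c ≈ 0# → Carrier
    inv c c≉0 = proj₁ (inverse c c≉0)

    inv-cancel : ∀ c (c≉0 : ¬ c ≈ 0#) y → c ⊗ (inv c c≉0 ⊗ y) ≈ y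
    inv-cancel c c≉0 y = ≈-trans (≈-sym (*-assoc _ _ _)) (≈-trans (*-cong (proj₂ (inverse c c≉0)) ≈-refl) (*-identityˡ y))

    cancel : ∀ c {y} → ¬ c ≈ 0# → c ⊗ y ≈ 0# → y ≈ 0#
    cancel c {y} c≉0 cy≈0 = begin
      y                         ≈⟨ ≈-sym (inv-cancel c c≉0 y) ⟩
      c ⊗ (inv c c≉0 ⊗ y)       ≈⟨ *-cong ≈-refl (*-comm _ y) ⟩
      c ⊗ (y ⊗ inv c c≉0)       ≈⟨ ≈-sym (*-assoc c y _) ⟩
      c ⊗ y ⊗ inv c c≉0         ≈⟨ *-cong cy≈0 ≈-refl ⟩
      0# ⊗ inv c c≉0            ≈⟨ zeroˡ _ ⟩
      0#                        ∎

    lead-^ : ∀ h d {c} → HasLead h d c → ¬ c ≈ 0# → ∀ t → ∃[ c′ ] (HasLead (h ^ₚ t) (t * d) c′ × ¬ c′ ≈ 0#)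
    lead-^ h d lead c≉0 zero    = 1# , (≈-refl , λ { (suc i) _ → ≈-refl }) , nontrivial
    lead-^ h d {c} lead c≉0 (suc t) with lead-^ h d lead c≉0 t
    ... | c′ , lead′ , c′≉0 =
      c′ ⊗ c ,
      ≡.subst (λ k → HasLead (h ^ₚ suc t) k (c′ ⊗ c)) (ℕ.+-comm (t * d) d) (lead-* (h ^ₚ t) h lead′ lead) ,
      λ c′c≈0 → c≉0 (cancel c′ c′≉0 c′c≈0)

    propagate-zero : ∀ h n {c} → HasLead h n c → ¬ c ≈ 0# → ∀ L v →
                     (∀ j → j < L → act h v j ≈ 0#) → (∀ i → i < n → v i ≈ 0#) → ∀ i → i < n + L → v i ≈ 0#
    propagate-zero h n lead c≉0 zero v hv≈0 v≈0 i i<n+0 = v≈0 i (≡.subst (i <_) (ℕ.+-identityʳ n) i<n+0)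
    propagate-zero h n {c} lead c≉0 (suc L) v hv≈0 v≈0 i i<n+L+1 =
      [ IH i , (λ i≡n+L → ≡.subst (λ k → v k ≈ 0#) (≡.sym i≡n+L) new) ]′
        (ℕ.m<1+n⇒m<n∨m≡n (≡.subst (i <_) (ℕ.+-suc n L) i<n+L+1))
      where
      IH : ∀ i → i < n + L → v i ≈ 0#
      IH = propagate-zero h n lead c≉0 L v (λ j j<L → hv≈0 j (ℕ.m<n⇒m<1+n j<L)) v≈0
      lower≈0 : act (take n h) v L ≈ 0#
      lower≈0 = ≈-trans (act-local (take n h) n (take-below n h) v 0ˢ L
                           (λ i i<n → IH (L + i) (≡.subst (L + i <_) (ℕ.+-comm L n) (ℕ.+-monoʳ-< L i<n))))
                        (act-0ˢ (take n h) (λ _ → ≈-refl) L)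
      new : v (n + L) ≈ 0#
      new = cancel c c≉0 (begin
        c ⊗ v (n + L)                            ≈⟨ ≈-sym (+-identityˡ _) ⟩
        0# ⊕ c ⊗ v (n + L)                       ≈⟨ +-cong (≈-sym lower≈0) (*-cong ≈-refl (≈-reflexive (cong v (ℕ.+-comm n L)))) ⟩
        act (take n h) v L ⊕ c ⊗ v (L + n)       ≈⟨ ≈-sym (split-lead h n lead v L) ⟩
        act h v L                                ≈⟨ hv≈0 L (ℕ.n<1+n L) ⟩
        0#                                       ∎)

    -- existence: if deg h = n + 1 with nonzero leading coefficient c, any
    -- values on [0, n] extend to a sequence annihilated by h, by solving
    -- (h·x)(j) = 0 for the newest entry x (j + n + 1)
    extend-solution : ∀ h n {c} → HasLead h (suc n) c → ¬ c ≈ 0# → ∀ init →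
                      ∃[ x ] (act h x ≐ 0ˢ × (∀ i → i < suc n → x i ≈ init i))
    extend-solution h n {c} lead c≉0 init = x , hx≐0 , λ i i≤n → ≈-sym (window≈x 0 i i≤n)
      where
      low : P
      low = take (suc n) h

      -- window j = (x j, …, x (j + n)); each window slides the previous one
      -- by one place and appends the next entry
      window : ℕ → Seq
      next   : ℕ → Carrier
      window zero    = init
      window (suc j) i with i <? n
      ... | yes _ = window j (suc i)
      ... | no  _ = next j
      next j = ⊝ (inv c c≉0 ⊗ act low (window j) 0)

      x : Seq
      x j = window j 0

      slide : ∀ j i → i < n → window (suc j) i ≡ window j (suc i)
      slide j i i<n with i <? n
      ... | yes _   = refl
      ... | no  i≮n = ⊥-elim (i≮n i<n)

      newest : ∀ j → window (suc j) n ≡ next j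
      newest j with n <? n
      ... | yes n<n = ⊥-elim (ℕ.<-irrefl refl n<n)
      ... | no  _   = refl

      window≈x : ∀ j i → i < suc n → window j i ≈ x (j + i)
      window≈x j zero    _         = ≈-reflexive (cong (λ k → window k 0) (≡.sym (ℕ.+-identityʳ j)))
      window≈x j (suc i) (s≤s i<n) = begin
        window j (suc i)   ≡⟨ ≡.sym (slide j i i<n) ⟩
        window (suc j) i   ≈⟨ window≈x (suc j) i (ℕ.m<n⇒m<1+n i<n) ⟩
        x (suc j + i)      ≡⟨ cong x (≡.sym (ℕ.+-suc j i)) ⟩
        x (j + suc i)      ∎

      hx≐0 : act h x ≐ 0ˢ
      hx≐0 j = begin
        act h x j                          ≈⟨ split-lead h (suc n) lead x j ⟩
        act low x j ⊕ c ⊗ x (j + suc n)    ≈⟨ +-cong low≈ (*-cong ≈-refl newest≈) ⟩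
        S ⊕ c ⊗ ⊝ (inv c c≉0 ⊗ S)          ≈⟨ +-cong ≈-refl (≈-trans (≈-sym (-‿distribʳ-* c _)) (-‿cong (inv-cancel c c≉0 S))) ⟩
        S ⊕ ⊝ S                            ≈⟨ -‿inverseʳ S ⟩
        0#                                 ∎
        where
        S : Carrier
        S = act low (window j) 0
        low≈ : act low x j ≈ S
        low≈ = begin
          act low x j                  ≡⟨ cong (act low x) (≡.sym (ℕ.+-identityʳ j)) ⟩
          act low x (j + 0)            ≈⟨ ≈-sym (act-shift low x j 0) ⟩
          act low (λ i → x (j + i)) 0  ≈⟨ act-local low (suc n) (take-below (suc n) h) _ _ 0 (λ i i≤n → ≈-sym (window≈x j i i≤n)) ⟩
          S                            ∎
        newest≈ : x (j + suc n) ≈ next j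
        newest≈ = begin
          x (j + suc n)      ≡⟨ cong x (ℕ.+-suc j n) ⟩
          x (suc j + n)      ≈⟨ ≈-sym (window≈x (suc j) n (ℕ.n<1+n n)) ⟩
          window (suc j) n   ≡⟨ newest j ⟩
          next j             ∎

    -- If u·A + v·B = 1, deg Aᵗ = m with nonzero leading coefficient and
    -- deg Bᵗ ≤ m, then a sequence w with Aᵗ·w and Bᵗ·w vanishing on [0, m)
    -- vanishes on [0, 2m).  (Extend w|[0,m) to a solution x of Aᵗ·x = 0;
    -- uniqueness makes x = w on [0, 2m), then Bᵗ·x solves the same recurrence
    -- and starts with m zeros, so it vanishes and x = 0 by coprimality.)
    kernel : ∀ {A B} → Combination A B oneₚ → ∀ t m {c} → HasLead (A ^ₚ t) m c → ¬ c ≈ 0# →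
             Below (B ^ₚ t) (suc m) → ∀ w →
             (∀ j → j < m → act (A ^ₚ t) w j ≈ 0#) → (∀ j → j < m → act (B ^ₚ t) w j ≈ 0#) →
             ∀ i → i < m + m → w i ≈ 0#
    kernel AB=1 t zero    lead c≉0 B-below w Aw≈0 Bw≈0 i ()
    kernel {A} {B} AB=1 t (suc m) lead c≉0 B-below w Aw≈0 Bw≈0 i i<2m =
      ≈-trans (≈-sym (x≈w i i<2m)) (x≐0 i)
      where
      Aᵗ Bᵗ : P
      Aᵗ = A ^ₚ t
      Bᵗ = B ^ₚ t
      solution : ∃[ x ] (act Aᵗ x ≐ 0ˢ × (∀ i → i < suc m → x i ≈ w i))
      solution = extend-solution Aᵗ m lead c≉0 w
      x : Seq
      x = proj₁ solution
      Aᵗx≐0 : act Aᵗ x ≐ 0ˢ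
      Aᵗx≐0 = proj₁ (proj₂ solution)

      x≈w : ∀ i → i < suc m + suc m → x i ≈ w i
      x≈w i i<2m = x∙y⁻¹≈ε⇒x≈y _ _ (propagate-zero Aᵗ (suc m) lead c≉0 (suc m) (x +ˢ -ˢ w) Aᵗd≈0 d≈0 i i<2m)
        where
        Aᵗd≈0 : ∀ j → j < suc m → act Aᵗ (x +ˢ -ˢ w) j ≈ 0#
        Aᵗd≈0 j j<m = begin
          act Aᵗ (x +ˢ -ˢ w) j             ≈⟨ act-+ˢ Aᵗ x _ j ⟩
          act Aᵗ x j ⊕ act Aᵗ (-ˢ w) j     ≈⟨ +-cong (Aᵗx≐0 j) (≈-trans (act-negˢ Aᵗ w j) (-‿cong (Aw≈0 j j<m))) ⟩
          0# ⊕ ⊝ 0#                        ≈⟨ +-identityˡ _ ⟩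
          ⊝ 0#                             ≈⟨ -0#≈0# ⟩
          0#                               ∎
        d≈0 : ∀ i → i < suc m → x i ⊕ ⊝ w i ≈ 0#
        d≈0 i i<m = ≈-trans (+-cong (proj₂ (proj₂ solution) i i<m) ≈-refl) (-‿inverseʳ (w i))

      -- y = Bᵗ·x is annihilated by Aᵗ and vanishes on [0, m), hence everywhere
      y≐0 : act Bᵗ x ≐ 0ˢ
      y≐0 n = propagate-zero Aᵗ (suc m) lead c≉0 (suc n) (act Bᵗ x) (λ j _ → Aᵗy≈0 j) y≈0 n
                (ℕ.<-≤-trans (ℕ.n<1+n n) (ℕ.m≤n+m (suc n) (suc m)))
        where
        Aᵗy≈0 : ∀ j → act Aᵗ (act Bᵗ x) j ≈ 0#
        Aᵗy≈0 j = ≈-trans (act-comm Aᵗ Bᵗ x j) (act-0ˢ Bᵗ Aᵗx≐0 j)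
        y≈0 : ∀ j → j < suc m → act Bᵗ x j ≈ 0#
        y≈0 j j<m = ≈-trans (act-local Bᵗ (suc (suc m)) B-below x w j
                               (λ i i≤m → x≈w (j + i) (ℕ.+-mono-<-≤ j<m (ℕ.≤-pred i≤m))))
                            (Bw≈0 j j<m)

      x≐0 : x ≐ 0ˢ
      x≐0 = coprime-powers AB=1 t t x Aᵗx≐0 y≐0

    -- X is invertible modulo B when B(0) ≠ 0:  b·h = h·B − B′·(X·h)
    cancel-X : ∀ {A B h} → ¬ coef B 0 ≈ 0# → Combination A B (0# ∷ h) → Combination A B h
    cancel-X {B = []} 0≉0 _ = ⊥-elim (0≉0 ≈-refl)
    cancel-X {A} {b ∷ B′} {h} b≉0 Xh∈ =
      combination-cong h≐ (combination-+ (combination-· b⁻¹ (combination-* h combination-right))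
                                         (combination-· (⊝ b⁻¹) (combination-* B′ Xh∈)))
      where
      b⁻¹ : Carrier
      b⁻¹ = inv b b≉0
      h≐ : ∀ x → act (b⁻¹ ·ₚ (h *ₚ (b ∷ B′)) +ₚ (⊝ b⁻¹) ·ₚ (B′ *ₚ (0# ∷ h))) x ≐ act h x
      h≐ x n = begin
        act (b⁻¹ ·ₚ (h *ₚ (b ∷ B′)) +ₚ (⊝ b⁻¹) ·ₚ (B′ *ₚ (0# ∷ h))) x n
          ≈⟨ ≈-trans (act-+ₚ (b⁻¹ ·ₚ (h *ₚ (b ∷ B′))) _ x n)
                     (+-cong (act-·ₚ b⁻¹ (h *ₚ (b ∷ B′)) x n) (act-·ₚ (⊝ b⁻¹) (B′ *ₚ (0# ∷ h)) x n)) ⟩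
        b⁻¹ ⊗ hB ⊕ (⊝ b⁻¹) ⊗ B′Xh
          ≈⟨ +-cong ≈-refl (≈-trans (≈-sym (-‿distribˡ-* _ _)) (-‿distribʳ-* _ _)) ⟩
        b⁻¹ ⊗ hB ⊕ b⁻¹ ⊗ ⊝ B′Xh
          ≈⟨ ≈-sym (distribˡ b⁻¹ _ _) ⟩
        b⁻¹ ⊗ (hB ⊕ ⊝ B′Xh)
          ≈⟨ *-cong ≈-refl (X-identity b B′ h x n) ⟩
        b⁻¹ ⊗ (b ⊗ act h x n)
          ≈⟨ *-swap _ _ _ ⟩
        b ⊗ (b⁻¹ ⊗ act h x n)
          ≈⟨ inv-cancel b b≉0 _ ⟩
        act h x n ∎
        where
        hB B′Xh : Carrier
        hB   = act (h *ₚ (b ∷ B′)) x n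
        B′Xh = act (B′ *ₚ (0# ∷ h)) x n

    cancel-Xᵏ : ∀ {A B} k {h} → ¬ coef B 0 ≈ 0# → Combination A B (shiftₚ k h) → Combination A B h
    cancel-Xᵏ zero    B0≉0 Xᵏh∈ = Xᵏh∈
    cancel-Xᵏ (suc k) B0≉0 Xᵏh∈ = cancel-Xᵏ k B0≉0 (cancel-X B0≉0 Xᵏh∈)

    constant-unit : ∀ d {c} → HasLead d 0 c → ¬ c ≈ 0# → IsUnitₚ K d
    constant-unit d {c} lead c≉0 = [ c⁻¹ ] , act-injective (d *ₚ [ c⁻¹ ]) oneₚ λ x n → begin
      act (d *ₚ [ c⁻¹ ]) x n                           ≈⟨ act-* d _ x n ⟩
      act d (act [ c⁻¹ ] x) n                          ≈⟨ split-lead d 0 lead _ n ⟩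
      0# ⊕ c ⊗ (c⁻¹ ⊗ x (n + 0) ⊕ 0#)                  ≈⟨ +-identityˡ _ ⟩
      c ⊗ (c⁻¹ ⊗ x (n + 0) ⊕ 0#)                       ≈⟨ *-cong ≈-refl (+-identityʳ _) ⟩
      c ⊗ (c⁻¹ ⊗ x (n + 0))                            ≈⟨ inv-cancel c c≉0 _ ⟩
      x (n + 0)                                        ≡⟨ cong x (ℕ.+-identityʳ n) ⟩
      x n                                              ≈⟨ ≈-sym (act-one x n) ⟩
      act oneₚ x n                                     ∎
      where
      c⁻¹ : Carrier
      c⁻¹ = inv c c≉0

    -- With decidable equality: the Euclidean algorithm run from the
    -- constant-term end yields Bézout identities, and every polynomial has a
    -- degree; this is where the two directions of the theorem are proved.

    module Discrete (_≟_ : Decidable _≈_) where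

      strip-zeros : ∀ C → ∃[ k ] ∃[ D ] ((∀ x n → act C x n ≈ act D x (k + n)) ×
                                          length D ≤ length C × (D ≡ [] ⊎ ¬ coef D 0 ≈ 0#))
      strip-zeros []      = 0 , [] , (λ x n → ≈-refl) , z≤n , inj₁ refl
      strip-zeros (a ∷ C) with a ≟ 0# | strip-zeros C
      ... | no  a≉0 | _ = 0 , a ∷ C , (λ x n → ≈-refl) , ℕ.≤-refl , inj₂ a≉0
      ... | yes a≈0 | k , D , C≐ , D≤C , D-form = suc k , D , XC≐ , ℕ.m≤n⇒m≤1+n D≤C , D-form
        where
        XC≐ : ∀ x n → act (a ∷ C) x n ≈ act D x (suc k + n)
        XC≐ x n = ≈-trans (+-cong (*-cong a≈0 ≈-refl) ≈-refl)
                    (≈-trans (act-X C x n) (≈-trans (C≐ x (suc n)) (≈-reflexive (cong (act D x) (ℕ.+-suc k n)))))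

      division-step : ∀ A B → ¬ coef B 0 ≈ 0# → length B ≤ length A →
        ∃[ c ] ∃[ k ] ∃[ D ] (Reduces A B c (suc k) D × length D < length A × (D ≡ [] ⊎ ¬ coef D 0 ≈ 0#))
      division-step []       []       B0≉0 _ = ⊥-elim (B0≉0 ≈-refl)
      division-step (α ∷ A′) []       B0≉0 _ = ⊥-elim (B0≉0 ≈-refl)
      division-step (α ∷ A′) (β ∷ B′) β≉0 (s≤s B′≤A′) = finish (strip-zeros C)
        where
        c : Carrier
        c = α ⊗ inv β β≉0
        C : P
        C = A′ +ₚ (⊝ c) ·ₚ B′
        cβ≈α : c ⊗ β ≈ α
        cβ≈α = ≈-trans (*-assoc _ _ _)
                 (≈-trans (*-cong ≈-refl (≈-trans (*-comm _ _) (proj₂ (inverse β β≉0)))) (*-identityʳ α))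
        A≈ : ∀ x n → act (α ∷ A′) x n ≈ c ⊗ act (β ∷ B′) x n ⊕ act C x (suc n)
        A≈ x n = ≈-sym (begin
          c ⊗ (β ⊗ x n ⊕ Bt) ⊕ act C x (suc n)
            ≈⟨ +-cong (distribˡ c _ _) (≈-trans (act-+ₚ A′ _ x _) (+-cong ≈-refl (act-·ₚ (⊝ c) B′ x _))) ⟩
          (c ⊗ (β ⊗ x n) ⊕ c ⊗ Bt) ⊕ (At ⊕ (⊝ c) ⊗ Bt)
            ≈⟨ +-cong (+-cong (≈-trans (≈-sym (*-assoc c β _)) (*-cong cβ≈α ≈-refl)) ≈-refl)
                      (+-cong ≈-refl (≈-sym (-‿distribˡ-* c Bt))) ⟩
          (α ⊗ x n ⊕ c ⊗ Bt) ⊕ (At ⊕ ⊝ (c ⊗ Bt))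
            ≈⟨ interchange _ _ _ _ ⟩
          (α ⊗ x n ⊕ At) ⊕ (c ⊗ Bt ⊕ ⊝ (c ⊗ Bt))
            ≈⟨ +-cong ≈-refl (-‿inverseʳ _) ⟩
          (α ⊗ x n ⊕ At) ⊕ 0#
            ≈⟨ +-identityʳ _ ⟩
          α ⊗ x n ⊕ At ∎)
          where
          At Bt : Carrier
          At = act A′ x (suc n)
          Bt = act B′ x (suc n)
        finish : ∃[ k ] ∃[ D ] ((∀ x n → act C x n ≈ act D x (k + n)) × length D ≤ length C ×
                               (D ≡ [] ⊎ ¬ coef D 0 ≈ 0#)) →
                 ∃[ c ] ∃[ k ] ∃[ D ] (Reduces (α ∷ A′) (β ∷ B′) c (suc k) D × length D < suc (length A′) ×
                                       (D ≡ [] ⊎ ¬ coef D 0 ≈ 0#))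
        finish (k , D , C≐ , D≤C , D-form) =
          c , k , D ,
          reduces (λ x n → ≈-trans (A≈ x n)
                             (+-cong ≈-refl (≈-trans (C≐ x (suc n)) (≈-reflexive (cong (act D x) (ℕ.+-suc k n)))))) ,
          s≤s (ℕ.≤-trans D≤C (length-+ₚ A′ _ (ℕ.≤-trans (ℕ.≤-reflexive (length-·ₚ (⊝ c) B′)) B′≤A′))) ,
          D-form

      mutual
        bezout : ∀ N A B → length A + length B ≤ N → ¬ coef A 0 ≈ 0# → ¬ coef B 0 ≈ 0# →
                 RelativelyPrime K A B → Combination A B oneₚ
        bezout N A B size A0≉0 B0≉0 coprime with length B ℕ.≤? length A
        ... | yes B≤A = bezout-ordered N A B size A0≉0 B0≉0 coprime B≤A
        ... | no  B≰A = combination-swap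
          (bezout-ordered N B A (≡.subst (_≤ N) (ℕ.+-comm (length A) (length B)) size) B0≉0 A0≉0
                          (λ g g∣B g∣A → coprime g g∣A g∣B) (ℕ.<⇒≤ (ℕ.≰⇒> B≰A)))

        bezout-ordered : ∀ N A B → length A + length B ≤ N → ¬ coef A 0 ≈ 0# → ¬ coef B 0 ≈ 0# →
                         RelativelyPrime K A B → length B ≤ length A → Combination A B oneₚ
        bezout-ordered zero    []      B _  A0≉0 _ _ _ = ⊥-elim (A0≉0 ≈-refl)
        bezout-ordered (suc N) A B size A0≉0 B0≉0 coprime B≤A with division-step A B B0≉0 B≤A
        -- A = c·B: B divides A, so B is a unit
        ... | c , k , D , A≈ , D<A , inj₁ refl =
          unit-combination A B (coprime B (reduces-divisors A≈ B (∣-zero B) (∣-refl B)) (∣-refl B))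
        -- D lies in (A, B) and (D, B) is a smaller coprime pair
        ... | c , k , D , A≈ , D<A , inj₂ D0≉0 =
          combination-trans (cancel-Xᵏ (suc k) B0≉0 (reduces-combination A≈))
                            (bezout N D B smaller D0≉0 B0≉0 (λ g g∣D g∣B → coprime g (reduces-divisors A≈ g g∣D g∣B) g∣B))
          where
          smaller : length D + length B ≤ N
          smaller = ℕ.≤-pred (ℕ.≤-trans (ℕ.+-monoˡ-≤ (length B) D<A) size)

      degree-split : ∀ d → Below d 0 ⊎ ∃[ k ] ∃[ c ] (HasLead d k c × ¬ c ≈ 0#)
      degree-split []      = inj₁ (λ _ _ → ≈-refl)
      degree-split (a ∷ d) with degree-split d | a ≟ 0#
      ... | inj₂ (k , c , (lead , below) , c≉0) | _       = inj₂ (suc k , c , (lead , λ { (suc i) (s≤s k<i) → below i k<i }) , c≉0)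
      ... | inj₁ d≈0                            | yes a≈0 = inj₁ λ { zero _ → a≈0 ; (suc i) _ → d≈0 i z≤n }
      ... | inj₁ d≈0                            | no  a≉0 = inj₂ (0 , a , (≈-refl , λ { (suc i) _ → d≈0 i z≤n }) , a≉0)

      coprime⇒injective : ∀ r t (a b : Vector Carrier (suc (2 * r))) → Bipermutive K r a → Bipermutive K r b →
        RelativelyPrime K (rulePoly K r a) (rulePoly K r b) → ∀ y y′ →
        CA K r t (linearRule K r a) y ≋ CA K r t (linearRule K r a) y′ →
        CA K r t (linearRule K r b) y ≋ CA K r t (linearRule K r b) y′ → y ≋ y′
      coprime⇒injective r t a b (a₀≉0 , aₗ≉0) (b₀≉0 , bₗ≉0) coprime y y′ Fa≋ Fb≋ f =
        x∙y⁻¹≈ε⇒x≈y _ _ (≈-trans (+-cong (extend-agrees y f) (-‿cong (extend-agrees y′ f)))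
                                 (kernel AB=1 t m leadᵃ cᵃ≉0 (proj₂ leadᵇ) w (vanishes a Fa≋) (vanishes b Fb≋)
                                         (toℕ f) (Fin.toℕ<n f)))
        where
        m : ℕ
        m = 2 * r * t
        AB=1 : Combination (toList a) (toList b) oneₚ
        AB=1 = bezout _ (toList a) (toList b) ℕ.≤-refl a₀≉0 b₀≉0 coprime
        power-lead : ∀ h → ¬ h (fromℕ (2 * r)) ≈ 0# → ∃[ c′ ] (HasLead (toList h ^ₚ t) m c′ × ¬ c′ ≈ 0#)
        power-lead h hₗ≉0 with lead-^ (toList h) (2 * r) (lead-toList (2 * r) h) hₗ≉0 t
        ... | c′ , lead , c′≉0 = c′ , ≡.subst (λ k → HasLead (toList h ^ₚ t) k c′) (ℕ.*-comm t (2 * r)) lead , c′≉0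
        cᵃ : Carrier
        cᵃ = proj₁ (power-lead a aₗ≉0)
        leadᵃ : HasLead (toList a ^ₚ t) m cᵃ
        leadᵃ = proj₁ (proj₂ (power-lead a aₗ≉0))
        cᵃ≉0 : ¬ cᵃ ≈ 0#
        cᵃ≉0 = proj₂ (proj₂ (power-lead a aₗ≉0))
        leadᵇ : HasLead (toList b ^ₚ t) m (proj₁ (power-lead b bₗ≉0))
        leadᵇ = proj₁ (proj₂ (power-lead b bₗ≉0))
        w : Seq
        w = extend y +ˢ -ˢ extend y′
        vanishes : ∀ h → CA K r t (linearRule K r h) y ≋ CA K r t (linearRule K r h) y′ →
                   ∀ j → j < m → act (toList h ^ₚ t) w j ≈ 0#
        vanishes h F≋ j j<m = begin
          act Hᵗ w j                                         ≈⟨ act-+ˢ Hᵗ _ _ j ⟩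
          act Hᵗ (extend y) j ⊕ act Hᵗ (-ˢ extend y′) j      ≈⟨ +-cong ≈-refl (act-negˢ Hᵗ _ j) ⟩
          act Hᵗ (extend y) j ⊕ ⊝ act Hᵗ (extend y′) j       ≈⟨ +-cong (at y) (-‿cong (at y′)) ⟩
          F y k ⊕ ⊝ F y′ k                                   ≈⟨ +-cong (F≋ k) ≈-refl ⟩
          F y′ k ⊕ ⊝ F y′ k                                  ≈⟨ -‿inverseʳ _ ⟩
          0#                                                 ∎
          where
          Hᵗ : P
          Hᵗ = toList h ^ₚ t
          F : Vector Carrier (m + m) → Vector Carrier m
          F = CA K r t (linearRule K r h)
          k : Fin m
          k = fromℕ< j<m
          at : ∀ z → act Hᵗ (extend z) j ≈ F z k
          at z = ≈-trans (≈-reflexive (cong (act Hᵗ (extend z)) (≡.sym (Fin.toℕ-fromℕ< j<m))))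
                         (≈-sym (CA-represents r h t z (extend z) (extend-agrees z) k))

      coprime⇒orthogonal : ∀ {q} r t (a b : Vector Carrier (suc (2 * r))) → Bipermutive K r a → Bipermutive K r b →
        (φ : Inverse (≋-setoid (2 * r * t)) (≡.setoid (Fin (q ^ (2 * r * t))))) →
        RelativelyPrime K (rulePoly K r a) (rulePoly K r b) →
        Orthogonal (assocSquare K φ (CA K r t (linearRule K r a))) (assocSquare K φ (CA K r t (linearRule K r b)))
      coprime⇒orthogonal r t a b bip-a bip-b φ coprime =
        orthogonal-if-injective φ _ _ (coprime⇒injective r t a b bip-a bip-b coprime)

      -- a common divisor of positive degree has a nonzero solution, which is
      -- a common solution of both rules; so only units divide both
      orthogonal⇒coprime : ∀ {q} r t (a b : Vector Carrier (suc (2 * r))) → ¬ a Fin.zero ≈ 0# → 1 ≤ t → 1 ≤ 2 * r * t →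
        (φ : Inverse (≋-setoid (2 * r * t)) (≡.setoid (Fin (q ^ (2 * r * t))))) →
        Orthogonal (assocSquare K φ (CA K r t (linearRule K r a))) (assocSquare K φ (CA K r t (linearRule K r b))) →
        RelativelyPrime K (rulePoly K r a) (rulePoly K r b)
      orthogonal⇒coprime r t a b a₀≉0 t≥1 m≥1 φ orthogonal d d∣a@(e , de≈a) d∣b with degree-split d
      ... | inj₁ d≈0 = ⊥-elim (a₀≉0 (≈-trans (≈-sym (de≈a 0)) (below-zero-* d d≈0 e 0 z≤n)))
      ... | inj₂ (zero , c , lead , c≉0) = constant-unit d lead c≉0
      ... | inj₂ (suc k , c , lead , c≉0) with extend-solution d k lead c≉0 (λ _ → 1#)
      ...   | S , dS≐0 , S≈1 = ⊥-elim (common-solution⇒¬orthogonal r t a b t≥1 m≥1 φ S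
                                 (divisor-annihilates d (toList a) d∣a S dS≐0) (divisor-annihilates d (toList b) d∣b S dS≐0)
                                 (λ S0≈0 → nontrivial (≈-trans (≈-sym (S≈1 0 (s≤s z≤n))) S0≈0)) orthogonal)

theorem1 : ∀ {c ℓ : Level} (K : CommutativeRing c ℓ) → IsField K →
    (q : ℕ) → IsPrimePower q → HasSize K q →
    (r : ℕ) → r ≥ 1 →
    (a b : Vector (CommutativeRing.Carrier K) (suc (2 * r))) →
    Bipermutive K r a → Bipermutive K r b →
    (t : ℕ) → t ≥ 1 →
    (φ : Inverse (VecEq.≋-setoid (CommutativeRing.setoid K) (2 * r * t)) (≡.setoid (Fin (q ^ (2 * r * t))))) →
    Orthogonal (assocSquare K φ (CA K r t (linearRule K r a))) (assocSquare K φ (CA K r t (linearRule K r b)))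
      ⇔ RelativelyPrime K (rulePoly K r a) (rulePoly K r b)
theorem1 K isField q _ size r r≥1 a b bip-a bip-b t t≥1 φ =
  mk⇔ (orthogonal⇒coprime r t a b (proj₁ bip-a) t≥1 m≥1 φ)
      (coprime⇒orthogonal r t a b bip-a bip-b φ)
  where
  open Theory K
  open Field isField
  -- a field with q elements has decidable equality
  open Discrete (via-injection (Inverse⇒Injection size) Fin._≟_)
  m≥1 : 1 ≤ 2 * r * t
  m≥1 = ℕ.*-mono-≤ {1} {2 * r} {1} {t} (ℕ.≤-trans r≥1 (ℕ.m≤m+n r _)) t≥1
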